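{- Let $r=r(n)$ be positive integers with $r=o(n^{1/2})$ as $n\to\infty$. In the random intersecting process on $\binom{[n]}{r}$ (described in the context), let $\mathcal{A}_2$ be the event that $|e_1\cap e_2|=1$ (i.e. $\{e_1,e_2\}$ is a $2$-star), and let $\mathcal{C}$ be the event that $e_3$ contains all of $e_1\cap e_2$ as well as at least one vertex of $(e_1\setminus e_2)\cup(e_2\setminus e_1)$. Then $\Pr(\mathcal{C}\mid\mathcal{A}_2)=o(1)$.
   Context: Random intersecting process: choose $e_1$ uniformly at random from $\binom{[n]}{r}$ (the $r$-subsets of $[n]=\{1,\dots,n\}$); given $\mathcal{F}_i=\{e_1,\ldots,e_i\}$, let $\mathcal{A}(\mathcal{F}_i)$ be the set of all $e\in\binom{[n]}{r}$, $e\notin\mathcal{F}_i$, with $e\cap e_j\ne\emptyset$ for all $j\le i$; choose $e_{i+1}$ uniformly at random from $\mathcal{A}(\mathcal{F}_i)$, halting when $\mathcal{A}(\mathcal{F}_i)=\emptyset$. -}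

module Defs where

open import Data.Bool using (Bool; true; false; _∧_; _∨_; not; if_then_else_)
open import Data.Nat as ℕ using (ℕ; zero; suc)
open import Data.Nat.Properties as ℕP using ()
open import Data.Fin using (Fin)
open import Data.Fin.Subset using (Subset; _∩_; _─_; _∪_; ∣_∣)
open import Data.Vec using (Vec; []; _∷_)
open import Data.List using (List; []; _∷_; filter; map; length; _++_)
open import Data.Bool.ListAction using (all; any)
open import Data.Integer using (+_)
open import Data.Rational using (ℚ; 0ℚ; _+_; _*_; _/_; _÷_; ≢-nonZero)
open import Data.Rational.Properties using (_≟_)
open import Relation.Nullary using (yes; no)
open import Relation.Nullary.Decidable using (⌊_⌋)

allSubsets : (n : ℕ) → List (Subset n)
allSubsets zero = [] ∷ []
allSubsets (suc n) = map (true ∷_) (allSubsets n) ++ map (false ∷_) (allSubsets n)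

rSets : (n r : ℕ) → List (Subset n)
rSets n r = filter (λ e → ℕ._≟_ ∣ e ∣ r) (allSubsets n)

eqS : ∀ {n} → Subset n → Subset n → Bool
eqS [] [] = true
eqS (x ∷ xs) (y ∷ ys) = (if x then y else not y) ∧ eqS xs ys

intersects : ∀ {n} → Subset n → Subset n → Bool
intersects e f = not ⌊ ℕ._≟_ ∣ e ∩ f ∣ 0 ⌋

avail : (n r : ℕ) → List (Subset n) → List (Subset n)
avail n r F = filter (λ e → Data.Bool._≟_
                        (not (any (eqS e) F) ∧ all (intersects e) F) true)
                     (rSets n r)
  where import Data.Bool

-- 1/k, with the (never used in a positive-weight branch) convention 1/0 = 0
inv : ℕ → ℚ
inv zero = 0ℚ
inv (suc k) = + 1 / suc k

sumℚ : List ℚ → ℚ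
sumℚ [] = 0ℚ
sumℚ (x ∷ xs) = x + sumℚ xs

indicator : Bool → ℚ
indicator true = + 1 / 1
indicator false = 0ℚ

isA2 : ∀ {n} → Subset n → Subset n → Bool
isA2 e1 e2 = ⌊ ℕ._≟_ ∣ e1 ∩ e2 ∣ 1 ⌋

isC : ∀ {n} → Subset n → Subset n → Subset n → Bool
isC e1 e2 e3 = eqS ((e1 ∩ e2) ∩ e3) (e1 ∩ e2)
             ∧ intersects e3 ((e1 ─ e2) ∪ (e2 ─ e1))

-- Pr(𝒜₂) in the random intersecting process on binom([n], r):
-- e₁ uniform on binom([n],r), e₂ uniform on 𝒜({e₁}).
probA2 : (n r : ℕ) → ℚ
probA2 n r = sumℚ (map term1 (rSets n r))
  where
  term1 : Subset n → ℚ
  term1 e1 = sumℚ (map term2 A1)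
    where
    A1 = avail n r (e1 ∷ [])
    term2 : Subset n → ℚ
    term2 e2 = indicator (isA2 e1 e2)
               * (inv (length (rSets n r)) * inv (length A1))

-- Pr(𝒜₂ ∩ 𝒞): additionally e₃ uniform on 𝒜({e₁,e₂}) (𝒞 requires e₃ to exist).
probA2C : (n r : ℕ) → ℚ
probA2C n r = sumℚ (map term1 (rSets n r))
  where
  term1 : Subset n → ℚ
  term1 e1 = sumℚ (map term2 A1)
    where
    A1 = avail n r (e1 ∷ [])
    term2 : Subset n → ℚ
    term2 e2 = sumℚ (map term3 A2)
      where
      A2 = avail n r (e1 ∷ e2 ∷ [])
      term3 : Subset n → ℚ
      term3 e3 = indicator (isA2 e1 e2 ∧ isC e1 e2 e3)
                 * (inv (length (rSets n r))
                    * (inv (length A1) * inv (length A2)))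

-- conditional probability Pr(X | Y) = Pr(X ∩ Y) / Pr(Y), set to 0 when Pr(Y) = 0
condProb : ℚ → ℚ → ℚ
condProb p q with q ≟ 0ℚ
... | yes _ = 0ℚ
... | no q≢0 = _÷_ p q {{≢-nonZero q≢0}}

probCgivenA2 : (n r : ℕ) → ℚ
probCgivenA2 n r = condProb (probA2C n r) (probA2 n r)

-- Fix a 2-star e₁, e₂ of r-sets, r = K + 1, with centre e₁ ∩ e₂ = {v} and 2K petal vertices
-- e₁ △ e₂. An e₃ realising 𝒞 contains v and meets a petal vertex, so there are at most
-- 2K·C(n−2, K−1) = (2K²/(n−1))·C(n−1, K) of them. Every r-set through v avoiding the petals is
-- admissible as e₃, and there are C(n−1−2K, K) ≥ (1 − 2K²/(n−1))·C(n−1, K) of those. Hence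
-- Pr(𝒞 | e₁, e₂) ≤ 1/p for every 2-star as soon as (p + 1)·2K² ≤ n − 1, and averaging over
-- (e₁, e₂) with p ≈ 1/ε and r² = o(n) gives the claim.

module Submission where

open import Defs
open import Data.Bool using (Bool; true; false; _∧_; not)
open import Data.Fin.Subset using (Subset; _∩_; ∣_∣)
open import Data.List using (List; []; _∷_; map; length)
import Data.Nat as ℕ
open import Data.Nat using (ℕ; zero; suc; _≥_; _^_; z≤n; s≤s)
import Data.Nat.Properties as ℕₚ
open import Data.Product using (Σ; _×_; _,_; proj₁; proj₂)
open import Function using (_∘_)
open import Relation.Binary.PropositionalEquality

module Combinatorics where

  open import Algebra.Properties.CommutativeSemigroup ℕₚ.+-commutativeSemigroup using (x∙yz≈y∙xz)
  open import Data.Bool using (if_then_else_)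
  import Data.Bool as Bool
  open import Data.Bool.ListAction using (all; any)
  open import Data.Bool.Properties using (∧-assoc; ∧-zeroʳ; ∧-identityʳ; ¬-not; T-≡)
  open import Data.Fin.Subset using (_─_; _∪_; _⊆_)
  open import Data.Fin.Subset.Properties using (∩-comm; ∪-comm; p⊆q⇒∣p∣≤∣q∣; x∈p∩q⁺; p∩q⊆p; p∩q⊆q; p─q⊆p; p⊆p∪q)
  open import Data.List using (filter; _++_)
  open import Data.List.Membership.Propositional using (_∈_)
  open import Data.List.Membership.Propositional.Properties using (∈-filter⁻)
  open import Data.Nat using (NonZero; _+_; _*_; _≤_; _≡ᵇ_)
  open import Data.Nat.Combinatorics using (_C_; nC1≡n; nCk+nC[k+1]≡[n+1]C[k+1])
  open import Data.Nat.Tactic.RingSolver using (solve-∀)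
  open import Data.Vec using (Vec; []; _∷_)
  import Data.Vec
  open import Function.Bundles using (Equivalence)
  open import Level using (0ℓ)
  open import Relation.Nullary using (does)
  open import Relation.Nullary.Decidable using (isYes≗does)
  open import Relation.Unary using (Pred; Decidable)

  countᵇ : {A : Set} → (A → Bool) → List A → ℕ
  countᵇ f []       = 0
  countᵇ f (x ∷ xs) = if f x then suc (countᵇ f xs) else countᵇ f xs

  module _ {A : Set} where

    countᵇ-cong : ∀ {f g : A → Bool} → f ≗ g → ∀ xs → countᵇ f xs ≡ countᵇ g xs
    countᵇ-cong f≗g []       = refl
    countᵇ-cong f≗g (x ∷ xs) rewrite f≗g x | countᵇ-cong f≗g xs = refl

    countᵇ-none : ∀ {f : A → Bool} → (∀ x → f x ≡ false) → ∀ xs → countᵇ f xs ≡ 0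
    countᵇ-none f≡false []       = refl
    countᵇ-none f≡false (x ∷ xs) rewrite f≡false x = countᵇ-none f≡false xs

    countᵇ-mono : ∀ {f g : A → Bool} → (∀ x → f x ≡ true → g x ≡ true) →
                  ∀ xs → countᵇ f xs ≤ countᵇ g xs
    countᵇ-mono f⇒g [] = z≤n
    countᵇ-mono {f} {g} f⇒g (x ∷ xs) with f x | g x | f⇒g x
    ... | true  | true  | _ = s≤s (countᵇ-mono f⇒g xs)
    ... | true  | false | h with () ← h refl
    ... | false | true  | _ = ℕₚ.m≤n⇒m≤1+n (countᵇ-mono f⇒g xs)
    ... | false | false | _ = countᵇ-mono f⇒g xs

    countᵇ-partition : ∀ (f g : A → Bool) xs →
      countᵇ f xs ≡ countᵇ (λ x → f x ∧ g x) xs + countᵇ (λ x → f x ∧ not (g x)) xs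
    countᵇ-partition f g [] = refl
    countᵇ-partition f g (x ∷ xs) with f x | g x
    ... | true  | true  = cong suc (countᵇ-partition f g xs)
    ... | true  | false = trans (cong suc (countᵇ-partition f g xs)) (sym (ℕₚ.+-suc _ _))
    ... | false | _     = countᵇ-partition f g xs

    countᵇ-++ : ∀ (f : A → Bool) xs ys → countᵇ f (xs ++ ys) ≡ countᵇ f xs + countᵇ f ys
    countᵇ-++ f []       ys = refl
    countᵇ-++ f (x ∷ xs) ys with f x
    ... | true  = cong suc (countᵇ-++ f xs ys)
    ... | false = countᵇ-++ f xs ys

    countᵇ-filter : ∀ {P : Pred A 0ℓ} (P? : Decidable P) (g : A → Bool) xs →
      countᵇ g (filter P? xs) ≡ countᵇ (λ x → does (P? x) ∧ g x) xs
    countᵇ-filter P? g [] = refl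
    countᵇ-filter P? g (x ∷ xs) with does (P? x)
    ... | false = countᵇ-filter P? g xs
    ... | true with g x
    ...   | true  = cong suc (countᵇ-filter P? g xs)
    ...   | false = countᵇ-filter P? g xs

    countᵇ-true : ∀ (xs : List A) → countᵇ (λ _ → true) xs ≡ length xs
    countᵇ-true []       = refl
    countᵇ-true (x ∷ xs) = cong suc (countᵇ-true xs)

  countᵇ-map : ∀ {A B : Set} (f : B → Bool) (h : A → B) xs →
               countᵇ f (map h xs) ≡ countᵇ (f ∘ h) xs
  countᵇ-map f h []       = refl
  countᵇ-map f h (x ∷ xs) with f (h x)
  ... | true  = cong suc (countᵇ-map f h xs)
  ... | false = countᵇ-map f h xs

  countᵇ-allSubsets : ∀ {n} (f : Subset (suc n) → Bool) →
    countᵇ f (allSubsets (suc n)) ≡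
    countᵇ (f ∘ (true ∷_)) (allSubsets n) + countᵇ (f ∘ (false ∷_)) (allSubsets n)
  countᵇ-allSubsets {n} f = begin
    countᵇ f (map (true ∷_) (allSubsets n) ++ map (false ∷_) (allSubsets n))
      ≡⟨ countᵇ-++ f (map (true ∷_) (allSubsets n)) _ ⟩
    countᵇ f (map (true ∷_) (allSubsets n)) + countᵇ f (map (false ∷_) (allSubsets n))
      ≡⟨ cong₂ _+_ (countᵇ-map f (true ∷_) (allSubsets n)) (countᵇ-map f (false ∷_) (allSubsets n)) ⟩
    countᵇ (f ∘ (true ∷_)) (allSubsets n) + countᵇ (f ∘ (false ∷_)) (allSubsets n) ∎
    where open ≡-Reasoning

  ∧-true⁻ : ∀ a {b} → a ∧ b ≡ true → a ≡ true × b ≡ true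
  ∧-true⁻ true  b≡true = refl , b≡true
  ∧-true⁻ false ()

  eqS-sound : ∀ {n} (p q : Subset n) → eqS p q ≡ true → p ≡ q
  eqS-sound []           []           _  = refl
  eqS-sound (true  ∷ p) (true  ∷ q) eq = cong (true ∷_) (eqS-sound p q eq)
  eqS-sound (false ∷ p) (false ∷ q) eq = cong (false ∷_) (eqS-sound p q eq)

  zipWith-cong : ∀ {A B C : Set} {n} {f g : A → B → C} → (∀ x y → f x y ≡ g x y) →
                 (xs : Vec A n) (ys : Vec B n) → Data.Vec.zipWith f xs ys ≡ Data.Vec.zipWith g xs ys
  zipWith-cong f≗g []       []       = refl
  zipWith-cong f≗g (x ∷ xs) (y ∷ ys) = cong₂ _∷_ (f≗g x y) (zipWith-cong f≗g xs ys)

  ─-∷ : ∀ {n} x y (p q : Subset n) → (x ∷ p) ─ (y ∷ q) ≡ (x ∧ not y) ∷ (p ─ q)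
  ─-∷ x true  p q = cong₂ _∷_ (sym (∧-zeroʳ x)) (zipWith-cong (λ { _ true → refl ; _ false → refl }) p q)
  ─-∷ x false p q = cong₂ _∷_ (sym (∧-identityʳ x)) (zipWith-cong (λ { _ true → refl ; _ false → refl }) p q)

  eqS-≢ : ∀ {n} {p q : Subset n} → p ≢ q → eqS p q ≡ false
  eqS-≢ {p = p} {q} p≢q = ¬-not (p≢q ∘ eqS-sound p q)

  ∣p∣≡∣p∩q∣+∣p─q∣ : ∀ {n} (p q : Subset n) → ∣ p ∣ ≡ ∣ p ∩ q ∣ + ∣ p ─ q ∣
  ∣p∣≡∣p∩q∣+∣p─q∣ []           []           = refl
  ∣p∣≡∣p∩q∣+∣p─q∣ (x ∷ p) (y ∷ q) =
    trans (head x y) (cong (λ d → ∣ (x ∷ p) ∩ (y ∷ q) ∣ + ∣ d ∣) (sym (─-∷ x y p q)))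
    where
    ih = ∣p∣≡∣p∩q∣+∣p─q∣ p q
    head : ∀ x y → ∣ x ∷ p ∣ ≡ ∣ (x ∷ p) ∩ (y ∷ q) ∣ + ∣ (x ∧ not y) ∷ (p ─ q) ∣
    head true  true  = cong suc ih
    head true  false = trans (cong suc ih) (sym (ℕₚ.+-suc _ _))
    head false _     = ih

  ≥1⇒≡ᵇ0-false : ∀ {m} → 1 ≤ m → (m ≡ᵇ 0) ≡ false
  ≥1⇒≡ᵇ0-false (s≤s _) = refl

  intersects-≡ᵇ : ∀ {n} (e f : Subset n) → intersects e f ≡ not (∣ e ∩ f ∣ ≡ᵇ 0)
  intersects-≡ᵇ e f = cong not (isYes≗does (∣ e ∩ f ∣ ℕ.≟ 0))

  isA2⇒∣e₁∩e₂∣≡1 : ∀ {n} (e₁ e₂ : Subset n) → isA2 e₁ e₂ ≡ true → ∣ e₁ ∩ e₂ ∣ ≡ 1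
  isA2⇒∣e₁∩e₂∣≡1 e₁ e₂ isA2≡true =
    ℕₚ.≡ᵇ⇒≡ _ 1 (Equivalence.from T-≡ (trans (sym (isYes≗does (∣ e₁ ∩ e₂ ∣ ℕ.≟ 1))) isA2≡true))

  common-⊆⇒intersects : ∀ {n} {s e f : Subset n} → s ⊆ e → s ⊆ f → 1 ≤ ∣ s ∣ → intersects e f ≡ true
  common-⊆⇒intersects {e = e} {f} s⊆e s⊆f 1≤∣s∣ = trans (intersects-≡ᵇ e f) (cong not (≥1⇒≡ᵇ0-false
    (ℕₚ.≤-trans 1≤∣s∣ (p⊆q⇒∣p∣≤∣q∣ (λ x∈s → x∈p∩q⁺ (s⊆e x∈s , s⊆f x∈s))))))

  _△_ : ∀ {n} → Subset n → Subset n → Subset n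
  p △ q = (p ─ q) ∪ (q ─ p)

  avoids-△⇒≢ˡ : ∀ {n} {e p q : Subset n} → ∣ e ∩ (p △ q) ∣ ≡ 0 → 1 ≤ ∣ p ─ q ∣ → e ≢ p
  avoids-△⇒≢ˡ {p = p} {q} ∣p∩[p△q]∣≡0 1≤∣p─q∣ refl = ℕₚ.<-irrefl refl
    (subst (1 ≤_) ∣p∩[p△q]∣≡0 (ℕₚ.≤-trans 1≤∣p─q∣ (p⊆q⇒∣p∣≤∣q∣ p─q⊆p∩[p△q])))
    where
    p─q⊆p∩[p△q] : p ─ q ⊆ p ∩ (p △ q)
    p─q⊆p∩[p△q] x∈ = x∈p∩q⁺ (p─q⊆p p q x∈ , p⊆p∪q (q ─ p) x∈)

  △-∷ : ∀ {n} x y (p q : Subset n) → (x ∷ p) △ (y ∷ q) ≡ ((x ∧ not y) Bool.∨ (y ∧ not x)) ∷ (p △ q)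
  △-∷ x y p q = cong₂ _∪_ (─-∷ x y p q) (─-∷ y x q p)

  △-comm : ∀ {n} (p q : Subset n) → p △ q ≡ q △ p
  △-comm p q = ∪-comm (p ─ q) (q ─ p)

  -- Counting subsets of [n] by pattern

  data Cell : Set where
    required forbidden free : Cell

  Pattern : ℕ → Set
  Pattern = Vec Cell

  matches : ∀ {n} → Pattern n → Subset n → Bool
  matches []              []      = true
  matches (required  ∷ p) (x ∷ e) = x ∧ matches p e
  matches (forbidden ∷ p) (x ∷ e) = not x ∧ matches p e
  matches (free      ∷ p) (x ∷ e) = matches p e

  #required #free : ∀ {n} → Pattern n → ℕ
  #required []             = 0
  #required (required ∷ p) = suc (#required p)
  #required (_        ∷ p) = #required p
  #free []         = 0
  #free (free ∷ p) = suc (#free p)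
  #free (_    ∷ p) = #free p

  -- The number of r-subsets of an (i + f)-set containing a fixed i-subset,
  -- i.e. f C (r ∸ i) when i ≤ r and 0 otherwise.
  #supersets : ℕ → ℕ → ℕ → ℕ
  #supersets f zero    r       = f C r
  #supersets f (suc i) zero    = 0
  #supersets f (suc i) (suc r) = #supersets f i r

  #supersets-suc-zero : ∀ f i → #supersets (suc f) i 0 ≡ #supersets f i 0
  #supersets-suc-zero f zero    = refl
  #supersets-suc-zero f (suc i) = refl

  #supersets-pascal : ∀ f i r →
    #supersets f i r + #supersets f i (suc r) ≡ #supersets (suc f) i (suc r)
  #supersets-pascal f zero    r       = nCk+nC[k+1]≡[n+1]C[k+1] f r
  #supersets-pascal f (suc i) zero    = sym (#supersets-suc-zero f i)
  #supersets-pascal f (suc i) (suc r) = #supersets-pascal f i r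

  fits : ∀ {n} → Pattern n → ℕ → Subset n → Bool
  fits p r e = matches p e ∧ (∣ e ∣ ≡ᵇ r)

  countᵇ-fits : ∀ {n} (p : Pattern n) r →
    countᵇ (fits p r) (allSubsets n) ≡ #supersets (#free p) (#required p) r
  countᵇ-fits [] zero    = refl
  countᵇ-fits [] (suc r) = refl
  countᵇ-fits {suc n} (required ∷ p) zero = trans (countᵇ-allSubsets (fits (required ∷ p) zero))
    (cong₂ _+_ (countᵇ-none (λ e → ∧-zeroʳ (matches p e)) (allSubsets n))
               (countᵇ-none (λ _ → refl) (allSubsets n)))
  countᵇ-fits {suc n} (required ∷ p) (suc r) = trans (countᵇ-allSubsets (fits (required ∷ p) (suc r)))
    (trans (cong₂ _+_ (countᵇ-fits p r) (countᵇ-none (λ _ → refl) (allSubsets n)))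
           (ℕₚ.+-identityʳ _))
  countᵇ-fits {suc n} (forbidden ∷ p) r = trans (countᵇ-allSubsets (fits (forbidden ∷ p) r))
    (cong₂ _+_ (countᵇ-none (λ _ → refl) (allSubsets n)) (countᵇ-fits p r))
  countᵇ-fits {suc n} (free ∷ p) zero = trans (countᵇ-allSubsets (fits (free ∷ p) zero))
    (trans (cong₂ _+_ (countᵇ-none (λ e → ∧-zeroʳ (matches p e)) (allSubsets n)) (countᵇ-fits p zero))
           (sym (#supersets-suc-zero (#free p) (#required p))))
  countᵇ-fits {suc n} (free ∷ p) (suc r) = trans (countᵇ-allSubsets (fits (free ∷ p) (suc r)))
    (trans (cong₂ _+_ (countᵇ-fits p r) (countᵇ-fits p (suc r)))
           (#supersets-pascal (#free p) (#required p) r))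

  requiring : ∀ {n} → Subset n → Pattern n
  requiring []          = []
  requiring (true  ∷ s) = required ∷ requiring s
  requiring (false ∷ s) = free ∷ requiring s

  matches-requiring : ∀ {n} (s e : Subset n) → matches (requiring s) e ≡ eqS (s ∩ e) s
  matches-requiring []          []          = refl
  matches-requiring (true  ∷ s) (true  ∷ e) = matches-requiring s e
  matches-requiring (true  ∷ s) (false ∷ e) = refl
  matches-requiring (false ∷ s) (_     ∷ e) = matches-requiring s e

  #required-requiring : ∀ {n} (s : Subset n) → #required (requiring s) ≡ ∣ s ∣
  #required-requiring []          = refl
  #required-requiring (true  ∷ s) = cong suc (#required-requiring s)
  #required-requiring (false ∷ s) = #required-requiring s

  ∣s∣+#free-requiring : ∀ {n} (s : Subset n) → ∣ s ∣ + #free (requiring s) ≡ n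
  ∣s∣+#free-requiring []          = refl
  ∣s∣+#free-requiring (true  ∷ s) = cong suc (∣s∣+#free-requiring s)
  ∣s∣+#free-requiring (false ∷ s) = trans (ℕₚ.+-suc _ _) (cong suc (∣s∣+#free-requiring s))

  matches-requiring⇒⊆ : ∀ {n} (s e : Subset n) → matches (requiring s) e ≡ true → s ⊆ e
  matches-requiring⇒⊆ s e m =
    subst (_⊆ e) (eqS-sound (s ∩ e) s (trans (sym (matches-requiring s e)) m)) (p∩q⊆q s e)

  starPattern : ∀ {n} → Subset n → Subset n → Pattern n
  starPattern []           []           = []
  starPattern (true  ∷ e₁) (true  ∷ e₂) = required  ∷ starPattern e₁ e₂
  starPattern (true  ∷ e₁) (false ∷ e₂) = forbidden ∷ starPattern e₁ e₂
  starPattern (false ∷ e₁) (true  ∷ e₂) = forbidden ∷ starPattern e₁ e₂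
  starPattern (false ∷ e₁) (false ∷ e₂) = free      ∷ starPattern e₁ e₂

  matches-starPattern : ∀ {n} (e₁ e₂ e : Subset n) →
    matches (starPattern e₁ e₂) e ≡ matches (requiring (e₁ ∩ e₂)) e ∧ (∣ e ∩ (e₁ △ e₂) ∣ ≡ᵇ 0)
  matches-starPattern []       []       []      = refl
  matches-starPattern (x ∷ e₁) (y ∷ e₂) (z ∷ e) = trans (head x y z)
    (cong (λ d → matches (requiring ((x ∷ e₁) ∩ (y ∷ e₂))) (z ∷ e) ∧ (∣ (z ∷ e) ∩ d ∣ ≡ᵇ 0))
          (sym (△-∷ x y e₁ e₂)))
    where
    ih = matches-starPattern e₁ e₂ e
    head : ∀ x y z → matches (starPattern (x ∷ e₁) (y ∷ e₂)) (z ∷ e) ≡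
           matches (requiring ((x ∷ e₁) ∩ (y ∷ e₂))) (z ∷ e) ∧
           (∣ (z ∷ e) ∩ (((x ∧ not y) Bool.∨ (y ∧ not x)) ∷ (e₁ △ e₂)) ∣ ≡ᵇ 0)
    head true  true  true  = ih
    head true  true  false = refl
    head true  false true  = sym (∧-zeroʳ _)
    head true  false false = ih
    head false true  true  = sym (∧-zeroʳ _)
    head false true  false = ih
    head false false true  = ih
    head false false false = ih

  #required-starPattern : ∀ {n} (e₁ e₂ : Subset n) → #required (starPattern e₁ e₂) ≡ ∣ e₁ ∩ e₂ ∣
  #required-starPattern []           []           = refl
  #required-starPattern (true  ∷ e₁) (true  ∷ e₂) = cong suc (#required-starPattern e₁ e₂)
  #required-starPattern (true  ∷ e₁) (false ∷ e₂) = #required-starPattern e₁ e₂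
  #required-starPattern (false ∷ e₁) (true  ∷ e₂) = #required-starPattern e₁ e₂
  #required-starPattern (false ∷ e₁) (false ∷ e₂) = #required-starPattern e₁ e₂

  #free-requiring-∩ : ∀ {n} (e₁ e₂ : Subset n) →
    #free (requiring (e₁ ∩ e₂)) ≡ #free (starPattern e₁ e₂) + (∣ e₁ ─ e₂ ∣ + ∣ e₂ ─ e₁ ∣)
  #free-requiring-∩ []       []       = refl
  #free-requiring-∩ (x ∷ e₁) (y ∷ e₂) = trans (head x y)
    (cong₂ (λ d d′ → #free (starPattern (x ∷ e₁) (y ∷ e₂)) + (∣ d ∣ + ∣ d′ ∣))
           (sym (─-∷ x y e₁ e₂)) (sym (─-∷ y x e₂ e₁)))
    where
    ih = #free-requiring-∩ e₁ e₂
    head : ∀ x y → #free (requiring ((x ∷ e₁) ∩ (y ∷ e₂))) ≡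
           #free (starPattern (x ∷ e₁) (y ∷ e₂)) + (∣ (x ∧ not y) ∷ (e₁ ─ e₂) ∣ + ∣ (y ∧ not x) ∷ (e₂ ─ e₁) ∣)
    head true  true  = ih
    head true  false = trans (cong suc ih) (sym (ℕₚ.+-suc _ _))
    head false true  = trans (cong suc ih) (sym (trans (cong (F +_) (ℕₚ.+-suc ∣ e₁ ─ e₂ ∣ _)) (ℕₚ.+-suc F _)))
      where F = #free (starPattern e₁ e₂)
    head false false = cong suc ih

  nCk≤[n+1]Ck : ∀ n k → n C k ≤ suc n C k
  nCk≤[n+1]Ck n zero    = ℕₚ.≤-refl
  nCk≤[n+1]Ck n (suc k) =
    ℕₚ.≤-trans (ℕₚ.m≤n+m (n C suc k) (n C k)) (ℕₚ.≤-reflexive (nCk+nC[k+1]≡[n+1]C[k+1] n k))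

  C-monoˡ-≤ : ∀ k {m n} → m ≤ n → m C k ≤ n C k
  C-monoˡ-≤ k m≤n = go (ℕₚ.≤⇒≤′ m≤n)
    where
    go : ∀ {m n} → m ℕ.≤′ n → m C k ≤ n C k
    go ℕ.≤′-refl       = ℕₚ.≤-refl
    go (ℕ.≤′-step m≤n) = ℕₚ.≤-trans (go m≤n) (nCk≤[n+1]Ck _ k)

  [k+1]*[n+1]C[k+1]≡[n+1]*nCk : ∀ n k → suc k * (suc n C suc k) ≡ suc n * (n C k)
  [k+1]*[n+1]C[k+1]≡[n+1]*nCk zero    zero    = refl
  [k+1]*[n+1]C[k+1]≡[n+1]*nCk zero    (suc k) = ℕₚ.*-zeroʳ (suc (suc k))
  [k+1]*[n+1]C[k+1]≡[n+1]*nCk (suc n) zero    =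
    trans (ℕₚ.+-identityʳ _) (trans (nC1≡n (suc (suc n))) (sym (ℕₚ.*-identityʳ _)))
  [k+1]*[n+1]C[k+1]≡[n+1]*nCk (suc n) (suc k) = begin
    suc (suc k) * (suc (suc n) C suc (suc k))
      ≡⟨ cong (suc (suc k) *_) (sym (nCk+nC[k+1]≡[n+1]C[k+1] (suc n) (suc k))) ⟩
    suc (suc k) * (A + B)
      ≡⟨ ℕₚ.*-distribˡ-+ (suc (suc k)) A B ⟩
    A + suc k * A + suc (suc k) * B
      ≡⟨ cong₂ (λ u v → A + u + v) ([k+1]*[n+1]C[k+1]≡[n+1]*nCk n k) ([k+1]*[n+1]C[k+1]≡[n+1]*nCk n (suc k)) ⟩
    A + suc n * (n C k) + suc n * (n C suc k)
      ≡⟨ ℕₚ.+-assoc A _ _ ⟩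
    A + (suc n * (n C k) + suc n * (n C suc k))
      ≡⟨ cong (A +_) (sym (ℕₚ.*-distribˡ-+ (suc n) (n C k) (n C suc k))) ⟩
    A + suc n * (n C k + n C suc k)
      ≡⟨ cong (λ c → A + suc n * c) (nCk+nC[k+1]≡[n+1]C[k+1] n k) ⟩
    suc (suc n) * A ∎
    where
    open ≡-Reasoning
    A = suc n C suc k
    B = suc n C suc (suc k)

  [n+m]C[k+1]≤nC[k+1]+m*oCk : ∀ n m k {o} → n + m ≤ suc o → (n + m) C suc k ≤ n C suc k + m * (o C k)
  [n+m]C[k+1]≤nC[k+1]+m*oCk n zero k _ = ℕₚ.≤-reflexive
    (trans (cong (_C suc k) (ℕₚ.+-identityʳ n)) (sym (ℕₚ.+-identityʳ _)))
  [n+m]C[k+1]≤nC[k+1]+m*oCk n (suc m) k {o} n+1+m≤1+o = begin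
    (n + suc m) C suc k            ≡⟨ cong (_C suc k) (ℕₚ.+-suc n m) ⟩
    suc (n + m) C suc k            ≡⟨ nCk+nC[k+1]≡[n+1]C[k+1] (n + m) k ⟨
    (n + m) C k + (n + m) C suc k  ≤⟨ ℕₚ.+-mono-≤ (C-monoˡ-≤ k (ℕₚ.≤-pred n+1+m≤1+o′))
                                        ([n+m]C[k+1]≤nC[k+1]+m*oCk n m k (ℕₚ.m≤n⇒m≤1+n (ℕₚ.≤-pred n+1+m≤1+o′))) ⟩
    o C k + (n C suc k + m * (o C k))  ≡⟨ x∙yz≈y∙xz (o C k) (n C suc k) (m * (o C k)) ⟩
    n C suc k + suc m * (o C k)    ∎
    where
    open ℕₚ.≤-Reasoning
    n+1+m≤1+o′ : suc (n + m) ≤ suc o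
    n+1+m≤1+o′ = subst (_≤ suc o) (ℕₚ.+-suc n m) n+1+m≤1+o

  -- If the excess B is at most m·X where X = K·T/S, then (p + 1)·m·K ≤ S gives
  -- p·B·S ≤ p·m·K·T ≤ (S − m·K)·T ≤ G·S.
  p*excess≤ : ∀ p B G T m X K S .{{_ : NonZero S}} → B + G ≤ T → T ≤ G + m * X →
              S * X ≡ K * T → suc p * (m * K) ≤ S → p * B ≤ G
  p*excess≤ p B G T m X K S B+G≤T T≤G+mX SX≡KT [1+p]mK≤S = ℕₚ.*-cancelʳ-≤ (p * B) G S (begin
    p * B * S        ≤⟨ ℕₚ.*-monoˡ-≤ S (ℕₚ.*-monoʳ-≤ p B≤mX) ⟩
    p * (m * X) * S  ≡⟨ reassoc₁ p m X S ⟩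
    p * m * (S * X)  ≡⟨ cong (p * m *_) SX≡KT ⟩
    p * m * (K * T)  ≤⟨ pmKT≤GS ⟩
    G * S            ∎)
    where
    open ℕₚ.≤-Reasoning
    reassoc₁ : ∀ p m X S → p * (m * X) * S ≡ p * m * (S * X)
    reassoc₁ = solve-∀
    reassoc₂ : ∀ p m K T → p * m * (K * T) + m * (K * T) ≡ suc p * (m * K) * T
    reassoc₂ = solve-∀
    reassoc₃ : ∀ S G m X → S * (G + m * X) ≡ G * S + m * (S * X)
    reassoc₃ = solve-∀
    B≤mX : B ≤ m * X
    B≤mX = ℕₚ.+-cancelʳ-≤ G B (m * X)
      (ℕₚ.≤-trans B+G≤T (ℕₚ.≤-trans T≤G+mX (ℕₚ.≤-reflexive (ℕₚ.+-comm G (m * X)))))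
    pmKT≤GS : p * m * (K * T) ≤ G * S
    pmKT≤GS = ℕₚ.+-cancelʳ-≤ (m * (K * T)) _ _ (begin
      p * m * (K * T) + m * (K * T)  ≡⟨ reassoc₂ p m K T ⟩
      suc p * (m * K) * T            ≤⟨ ℕₚ.*-monoˡ-≤ T [1+p]mK≤S ⟩
      S * T                          ≤⟨ ℕₚ.*-monoʳ-≤ S T≤G+mX ⟩
      S * (G + m * X)                ≡⟨ reassoc₃ S G m X ⟩
      G * S + m * (S * X)            ≡⟨ cong (λ z → G * S + m * z) SX≡KT ⟩
      G * S + m * (K * T)            ∎)

  p*excess≤nC[k+1] : ∀ p n j k B → B + n C suc k ≤ (n + suc j) C suc k →
                     suc p * (suc j * suc k) ≤ n + suc j → p * B ≤ n C suc k
  p*excess≤nC[k+1] p n j k B B+G≤T bound =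
    p*excess≤ p B (n C suc k) T (suc j) (o C k) (suc k) (suc o) B+G≤T
      ([n+m]C[k+1]≤nC[k+1]+m*oCk n (suc j) k (ℕₚ.≤-reflexive n+[1+j]≡1+o))
      (trans (sym ([k+1]*[n+1]C[k+1]≡[n+1]*nCk o k)) (cong (λ N → suc k * (N C suc k)) (sym n+[1+j]≡1+o)))
      (subst (suc p * (suc j * suc k) ≤_) n+[1+j]≡1+o bound)
    where
    o = n + j
    T = (n + suc j) C suc k
    n+[1+j]≡1+o : n + suc j ≡ suc o
    n+[1+j]≡1+o = ℕₚ.+-suc n j

  -- The 2-star {e₁, e₂}

  available : ∀ {n} → ℕ → List (Subset n) → Subset n → Bool
  available r F e = (∣ e ∣ ≡ᵇ r) ∧ (not (any (eqS e) F) ∧ all (intersects e) F)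

  does-≟-true : ∀ b → does (b Bool.≟ true) ≡ b
  does-≟-true true  = refl
  does-≟-true false = refl

  countᵇ-avail : ∀ n r F (g : Subset n → Bool) →
    countᵇ g (avail n r F) ≡ countᵇ (λ e → available r F e ∧ g e) (allSubsets n)
  countᵇ-avail n r F g =
    trans (countᵇ-filter _ g (rSets n r)) (trans (countᵇ-filter _ _ (allSubsets n)) (countᵇ-cong reassoc (allSubsets n)))
    where
    reassoc : ∀ e → (∣ e ∣ ≡ᵇ r) ∧ (does ((not (any (eqS e) F) ∧ all (intersects e) F) Bool.≟ true) ∧ g e) ≡
                    available r F e ∧ g e
    reassoc e = trans (cong (λ b → (∣ e ∣ ≡ᵇ r) ∧ (b ∧ g e)) (does-≟-true _)) (sym (∧-assoc (∣ e ∣ ≡ᵇ r) _ _))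

  length-avail : ∀ n r F → length (avail n r F) ≡ countᵇ (available r F) (allSubsets n)
  length-avail n r F = begin
    length (avail n r F)                                     ≡⟨ countᵇ-true (avail n r F) ⟨
    countᵇ (λ _ → true) (avail n r F)                        ≡⟨ countᵇ-avail n r F (λ _ → true) ⟩
    countᵇ (λ e → available r F e ∧ true) (allSubsets n)     ≡⟨ countᵇ-cong (∧-identityʳ ∘ available r F) (allSubsets n) ⟩
    countᵇ (available r F) (allSubsets n)                    ∎
    where open ≡-Reasoning

  module TwoStar {n K} (e₁ e₂ : Subset n) (∣e₁∣≡1+K : ∣ e₁ ∣ ≡ suc K) (∣e₂∣≡1+K : ∣ e₂ ∣ ≡ suc K)
                 (∣e₁∩e₂∣≡1 : ∣ e₁ ∩ e₂ ∣ ≡ 1) where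

    through clean admissible : Subset n → Bool
    through    = fits (requiring (e₁ ∩ e₂)) (suc K)
    clean      = fits (starPattern e₁ e₂) (suc K)
    admissible = available (suc K) (e₁ ∷ e₂ ∷ [])

    F : ℕ
    F = #free (starPattern e₁ e₂)

    ∣e₁─e₂∣≡K : ∣ e₁ ─ e₂ ∣ ≡ K
    ∣e₁─e₂∣≡K = ℕₚ.suc-injective (begin
      1 + ∣ e₁ ─ e₂ ∣              ≡⟨ cong (_+ ∣ e₁ ─ e₂ ∣) ∣e₁∩e₂∣≡1 ⟨
      ∣ e₁ ∩ e₂ ∣ + ∣ e₁ ─ e₂ ∣    ≡⟨ ∣p∣≡∣p∩q∣+∣p─q∣ e₁ e₂ ⟨
      ∣ e₁ ∣                       ≡⟨ ∣e₁∣≡1+K ⟩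
      suc K                        ∎)
      where open ≡-Reasoning

    ∣e₂─e₁∣≡K : ∣ e₂ ─ e₁ ∣ ≡ K
    ∣e₂─e₁∣≡K = ℕₚ.suc-injective (begin
      1 + ∣ e₂ ─ e₁ ∣              ≡⟨ cong (_+ ∣ e₂ ─ e₁ ∣) (trans (cong ∣_∣ (∩-comm e₂ e₁)) ∣e₁∩e₂∣≡1) ⟨
      ∣ e₂ ∩ e₁ ∣ + ∣ e₂ ─ e₁ ∣    ≡⟨ ∣p∣≡∣p∩q∣+∣p─q∣ e₂ e₁ ⟨
      ∣ e₂ ∣                       ≡⟨ ∣e₂∣≡1+K ⟩
      suc K                        ∎)
      where open ≡-Reasoning

    #free-through : #free (requiring (e₁ ∩ e₂)) ≡ F + (K + K)
    #free-through = trans (#free-requiring-∩ e₁ e₂) (cong₂ (λ a b → F + (a + b)) ∣e₁─e₂∣≡K ∣e₂─e₁∣≡K)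

    n≡1+F+2K : n ≡ suc (F + (K + K))
    n≡1+F+2K = trans (sym (∣s∣+#free-requiring (e₁ ∩ e₂))) (cong₂ _+_ ∣e₁∩e₂∣≡1 #free-through)

    #through : countᵇ through (allSubsets n) ≡ (F + (K + K)) C K
    #through = trans (countᵇ-fits (requiring (e₁ ∩ e₂)) (suc K))
      (cong₂ (λ f i → #supersets f i (suc K)) #free-through (trans (#required-requiring (e₁ ∩ e₂)) ∣e₁∩e₂∣≡1))

    #clean : countᵇ clean (allSubsets n) ≡ F C K
    #clean = trans (countᵇ-fits (starPattern e₁ e₂) (suc K))
      (cong (λ i → #supersets F i (suc K)) (trans (#required-starPattern e₁ e₂) ∣e₁∩e₂∣≡1))

    contains-centre avoids-petals : Subset n → Bool
    contains-centre e = matches (requiring (e₁ ∩ e₂)) e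
    avoids-petals   e = ∣ e ∩ (e₁ △ e₂) ∣ ≡ᵇ 0

    clean-≡ : ∀ e → clean e ≡ (contains-centre e ∧ avoids-petals e) ∧ (∣ e ∣ ≡ᵇ suc K)
    clean-≡ e = cong (_∧ (∣ e ∣ ≡ᵇ suc K)) (matches-starPattern e₁ e₂ e)

    isC-≡ : ∀ e → isC e₁ e₂ e ≡ contains-centre e ∧ not (avoids-petals e)
    isC-≡ e = cong₂ _∧_ (sym (matches-requiring (e₁ ∩ e₂) e)) (intersects-≡ᵇ e (e₁ △ e₂))

    𝒞⇒excess : ∀ e → admissible e ∧ isC e₁ e₂ e ≡ true → through e ∧ not (clean e) ≡ true
    𝒞⇒excess e h = subst (λ c → through e ∧ not c ≡ true) (sym (clean-≡ e))
      (tautology (proj₁ 𝒞) (not-true⁻ (proj₂ 𝒞)) (proj₁ (∧-true⁻ (∣ e ∣ ≡ᵇ suc K) (proj₁ h′))))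
      where
      h′ = ∧-true⁻ (admissible e) h
      𝒞 = ∧-true⁻ (contains-centre e) (trans (sym (isC-≡ e)) (proj₂ h′))
      not-true⁻ : ∀ {b} → not b ≡ true → b ≡ false
      not-true⁻ {false} _ = refl
      tautology : ∀ {a b c} → a ≡ true → b ≡ false → c ≡ true → (a ∧ c) ∧ not ((a ∧ b) ∧ c) ≡ true
      tautology refl refl refl = refl

    clean-parts : ∀ e → clean e ≡ true →
                  contains-centre e ≡ true × avoids-petals e ≡ true × (∣ e ∣ ≡ᵇ suc K) ≡ true
    clean-parts e h = proj₁ c∧a , proj₂ c∧a , proj₂ parts
      where
      parts = ∧-true⁻ (contains-centre e ∧ avoids-petals e) (trans (sym (clean-≡ e)) h)
      c∧a = ∧-true⁻ (contains-centre e) (proj₁ parts)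

    clean⇒through : ∀ e → clean e ≡ true → through e ∧ clean e ≡ true
    clean⇒through e h with clean-parts e h
    ... | c , _ , s = cong₂ _∧_ (cong₂ _∧_ c s) h

    clean⇒admissible : 1 ≤ K → ∀ e → clean e ≡ true → admissible e ≡ true
    clean⇒admissible 1≤K e h with clean-parts e h
    ... | c , a , s = tautology s
      (eqS-≢ (avoids-△⇒≢ˡ {e = e} {e₁} {e₂} avoids (ℕₚ.≤-trans 1≤K (ℕₚ.≤-reflexive (sym ∣e₁─e₂∣≡K)))))
      (eqS-≢ (avoids-△⇒≢ˡ {e = e} {e₂} {e₁} (trans (cong (λ d → ∣ e ∩ d ∣) (△-comm e₂ e₁)) avoids)
                          (ℕₚ.≤-trans 1≤K (ℕₚ.≤-reflexive (sym ∣e₂─e₁∣≡K)))))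
      (common-⊆⇒intersects centre⊆e (p∩q⊆p e₁ e₂) centre≠∅)
      (common-⊆⇒intersects centre⊆e (p∩q⊆q e₁ e₂) centre≠∅)
      where
      centre⊆e = matches-requiring⇒⊆ (e₁ ∩ e₂) e c
      centre≠∅ = ℕₚ.≤-reflexive (sym ∣e₁∩e₂∣≡1)
      avoids : ∣ e ∩ (e₁ △ e₂) ∣ ≡ 0
      avoids = ℕₚ.≡ᵇ⇒≡ _ 0 (Equivalence.from T-≡ a)
      tautology : ∀ {s a b c d} → s ≡ true → a ≡ false → b ≡ false → c ≡ true → d ≡ true →
                  s ∧ (not (a Bool.∨ (b Bool.∨ false)) ∧ (c ∧ (d ∧ true))) ≡ true
      tautology refl refl refl refl refl = refl

    excess : ℕ
    excess = countᵇ (λ e → through e ∧ not (clean e)) (allSubsets n)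

    #𝒞≤excess : countᵇ (isC e₁ e₂) (avail n (suc K) (e₁ ∷ e₂ ∷ [])) ≤ excess
    #𝒞≤excess = ℕₚ.≤-trans (ℕₚ.≤-reflexive (countᵇ-avail n (suc K) (e₁ ∷ e₂ ∷ []) (isC e₁ e₂)))
                            (countᵇ-mono 𝒞⇒excess (allSubsets n))

    excess+#clean≤#through : excess + F C K ≤ (F + (K + K)) C K
    excess+#clean≤#through = begin
      excess + F C K                                      ≡⟨ cong (excess +_) #clean ⟨
      excess + countᵇ clean (allSubsets n)                ≤⟨ ℕₚ.+-monoʳ-≤ excess (countᵇ-mono clean⇒through (allSubsets n)) ⟩
      excess + countᵇ (λ e → through e ∧ clean e) (allSubsets n)
                                                          ≡⟨ ℕₚ.+-comm excess _ ⟩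
      countᵇ (λ e → through e ∧ clean e) (allSubsets n) + excess
                                                          ≡⟨ countᵇ-partition through clean (allSubsets n) ⟨
      countᵇ through (allSubsets n)                       ≡⟨ #through ⟩
      (F + (K + K)) C K                                   ∎
      where open ℕₚ.≤-Reasoning

    #clean≤#A₂ : 1 ≤ K → F C K ≤ length (avail n (suc K) (e₁ ∷ e₂ ∷ []))
    #clean≤#A₂ 1≤K = begin
      F C K                                   ≡⟨ #clean ⟨
      countᵇ clean (allSubsets n)             ≤⟨ countᵇ-mono (clean⇒admissible 1≤K) (allSubsets n) ⟩
      countᵇ admissible (allSubsets n)        ≡⟨ length-avail n (suc K) (e₁ ∷ e₂ ∷ []) ⟨
      length (avail n (suc K) (e₁ ∷ e₂ ∷ [])) ∎
      where open ℕₚ.≤-Reasoning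

  p*#𝒞≤#A₂ : ∀ {n K} {e₁ e₂ : Subset n} p → ∣ e₁ ∣ ≡ suc K → ∣ e₂ ∣ ≡ suc K → ∣ e₁ ∩ e₂ ∣ ≡ 1 →
             suc (suc p * ((K + K) * K)) ≤ n →
             p * countᵇ (isC e₁ e₂) (avail n (suc K) (e₁ ∷ e₂ ∷ [])) ≤ length (avail n (suc K) (e₁ ∷ e₂ ∷ []))
  p*#𝒞≤#A₂ {K = zero} {e₁} {e₂} p ∣e₁∣≡1 ∣e₂∣≡1 ∣e₁∩e₂∣≡1 _ =
    ℕₚ.≤-trans (ℕₚ.≤-reflexive (trans (cong (p *_) #𝒞≡0) (ℕₚ.*-zeroʳ p))) z≤n
    where
    open TwoStar e₁ e₂ ∣e₁∣≡1 ∣e₂∣≡1 ∣e₁∩e₂∣≡1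
    #𝒞≡0 = ℕₚ.n≤0⇒n≡0 (ℕₚ.≤-trans #𝒞≤excess (ℕₚ.+-cancelʳ-≤ 1 excess 0 excess+#clean≤#through))
  p*#𝒞≤#A₂ {n} {suc k} {e₁} {e₂} p ∣e₁∣≡1+K ∣e₂∣≡1+K ∣e₁∩e₂∣≡1 bound = begin
    p * countᵇ (isC e₁ e₂) (avail n (suc (suc k)) (e₁ ∷ e₂ ∷ []))  ≤⟨ ℕₚ.*-monoʳ-≤ p #𝒞≤excess ⟩
    p * excess                                                       ≤⟨ p*excess≤nC[k+1] p F (k + suc k) k excess
                                                                          excess+#clean≤#through bound′ ⟩
    F C suc k                                                        ≤⟨ #clean≤#A₂ (s≤s z≤n) ⟩
    length (avail n (suc (suc k)) (e₁ ∷ e₂ ∷ []))                    ∎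
    where
    open TwoStar e₁ e₂ ∣e₁∣≡1+K ∣e₂∣≡1+K ∣e₁∩e₂∣≡1
    open ℕₚ.≤-Reasoning
    bound′ = ℕₚ.≤-pred (subst (_ ≤_) n≡1+F+2K bound)

  ∈rSets⇒∣e∣≡r : ∀ {n r} {e : Subset n} → e ∈ rSets n r → ∣ e ∣ ≡ r
  ∈rSets⇒∣e∣≡r {n} e∈ = proj₂ (∈-filter⁻ _ {xs = allSubsets n} e∈)

  ∈avail⇒∈rSets : ∀ {n r F} {e : Subset n} → e ∈ avail n r F → e ∈ rSets n r
  ∈avail⇒∈rSets {n} {r} e∈ = proj₁ (∈-filter⁻ _ {xs = rSets n r} e∈)

  1+q*[2K*K]≤[1+K]^2*[1+2q] : ∀ K q → suc (q * ((K + K) * K)) ≤ suc K ^ 2 * suc (q + q)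
  1+q*[2K*K]≤[1+K]^2*[1+2q] K q = ℕₚ.≤-trans (ℕₚ.m≤m+n _ _) (ℕₚ.≤-reflexive (sym (expand K q)))
    where
    expand : ∀ K q → (1 + K) * ((1 + K) * 1) * (1 + (q + q)) ≡
             1 + q * ((K + K) * K) + (K * K + (K + K) + (q + q) * (K + K + 1))
    expand = solve-∀

open Combinatorics
  using (countᵇ; countᵇ-none; isA2⇒∣e₁∩e₂∣≡1; p*#𝒞≤#A₂; ∈rSets⇒∣e∣≡r; ∈avail⇒∈rSets; 1+q*[2K*K]≤[1+K]^2*[1+2q])

-- Rationals: from here on _+_, _*_, _≤_ and _<_ are the operations on ℚ.

open import Data.Integer as ℤ using (+_; +≤+)
import Data.Integer.Properties as ℤₚ
open import Data.Rational using (ℚ; mkℚ; 0ℚ; 1ℚ; _/_; _+_; _*_; _≤_; _<_; 1/_; toℚᵘ; NonZero; NonNegative; Positive; positive; nonNegative; ≢-nonZero)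
import Data.Rational.Properties as ℚₚ
open import Data.Rational.Unnormalised using (mkℚᵘ; *≡*; *≤*) renaming (_≃_ to _≃ᵘ_)
import Data.Rational.Unnormalised.Properties as ℚᵘₚ
open import Data.List.Membership.Propositional using (_∈_)
open import Data.List.Relation.Unary.Any using (here; there)
open import Relation.Nullary using (yes; no)

/-≃ᵘ : ∀ a d → toℚᵘ (+ a / suc d) ≃ᵘ mkℚᵘ (+ a) d
/-≃ᵘ a d = ℚₚ.toℚᵘ-fromℚᵘ (mkℚᵘ (+ a) d)

/-mono-≤ : ∀ a d c e → a ℕ.* suc e ℕ.≤ c ℕ.* suc d → + a / suc d ≤ + c / suc e
/-mono-≤ a d c e ad≤cb = ℚₚ.toℚᵘ-cancel-≤
  (ℚᵘₚ.≤-respˡ-≃ (ℚᵘₚ.≃-sym (/-≃ᵘ a d)) (ℚᵘₚ.≤-respʳ-≃ (ℚᵘₚ.≃-sym (/-≃ᵘ c e))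
    (*≤* (subst₂ ℤ._≤_ (ℤₚ.pos-* a (suc e)) (ℤₚ.pos-* c (suc d)) (+≤+ ad≤cb)))))

/-cancel-≤ : ∀ a d c e → + a / suc d ≤ + c / suc e → a ℕ.* suc e ℕ.≤ c ℕ.* suc d
/-cancel-≤ a d c e a/d≤c/e with ℚᵘₚ.≤-respˡ-≃ (/-≃ᵘ a d) (ℚᵘₚ.≤-respʳ-≃ (/-≃ᵘ c e) (ℚₚ.toℚᵘ-mono-≤ a/d≤c/e))
... | *≤* ad≤cb = ℤₚ.drop‿+≤+ (subst₂ ℤ._≤_ (sym (ℤₚ.pos-* a (suc e))) (sym (ℤₚ.pos-* c (suc d))) ad≤cb)

[a/b]*[c/d]≡[a*c]/[b*d] : ∀ a d c e → (+ a / suc d) * (+ c / suc e) ≡ + (a ℕ.* c) / (suc d ℕ.* suc e)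
[a/b]*[c/d]≡[a*c]/[b*d] a d c e = ℚₚ.toℚᵘ-injective (ℚᵘₚ.≃-trans (ℚₚ.toℚᵘ-homo-* (+ a / suc d) (+ c / suc e))
  (ℚᵘₚ.≃-trans (ℚᵘₚ.*-cong (/-≃ᵘ a d) (/-≃ᵘ c e))
    (subst (λ i → mkℚᵘ i _ ≃ᵘ toℚᵘ (+ (a ℕ.* c) / (suc d ℕ.* suc e))) (ℤₚ.pos-* a c)
      (ℚᵘₚ.≃-sym (/-≃ᵘ (a ℕ.* c) _)))))

[m+n]/1≡m/1+n/1 : ∀ m n → + (m ℕ.+ n) / 1 ≡ + m / 1 + + n / 1
[m+n]/1≡m/1+n/1 m n = ℚₚ.toℚᵘ-injective (ℚᵘₚ.≃-trans (/-≃ᵘ (m ℕ.+ n) 0)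
  (ℚᵘₚ.≃-trans (*≡* (cong (ℤ._* + 1) (cong₂ ℤ._+_ (sym (ℤₚ.*-identityʳ (+ m))) (sym (ℤₚ.*-identityʳ (+ n))))))
    (ℚᵘₚ.≃-sym (ℚᵘₚ.≃-trans (ℚₚ.toℚᵘ-homo-+ (+ m / 1) (+ n / 1)) (ℚᵘₚ.+-cong (/-≃ᵘ m 0) (/-≃ᵘ n 0))))))

0≤/ : ∀ a d → 0ℚ ≤ + a / suc d
0≤/ a d = ℚₚ.nonNegative⁻¹ _ {{ℚₚ.normalize-nonNeg a (suc d)}}

0</ : ∀ a d → 0ℚ < + suc a / suc d
0</ a d = ℚₚ.positive⁻¹ _ {{ℚₚ.normalize-pos (suc a) (suc d)}}

archimedean : ∀ ε → 0ℚ < ε → Σ ℕ λ b → + 1 / suc b ≤ ε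
archimedean ε 0<ε = go ε (positive 0<ε)
  where
  go : ∀ ε → Positive ε → Σ ℕ λ b → + 1 / suc b ≤ ε
  go ε@(mkℚ (+ suc a) d _) _ = d , subst (+ 1 / suc d ≤_) (ℚₚ.↥p/↧p≡p ε)
    (/-mono-≤ 1 d (suc a) d (ℕₚ.*-monoˡ-≤ (suc d) (s≤s (z≤n {a}))))

sumℚ-indicator : ∀ {A : Set} (f : A → Bool) (w : ℚ) {h : A → ℚ} → (∀ x → h x ≡ indicator (f x) * w) →
                 ∀ xs → sumℚ (map h xs) ≡ (+ countᵇ f xs / 1) * w
sumℚ-indicator f w h≡ [] = sym (ℚₚ.*-zeroˡ w)
sumℚ-indicator f w {h} h≡ (x ∷ xs) with f x in fx
... | true  = begin
  h x + sumℚ (map h xs)             ≡⟨ cong₂ _+_ (trans (h≡ x) (cong (λ b → indicator b * w) fx))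
                                                  (sumℚ-indicator f w h≡ xs) ⟩
  1ℚ * w + (+ countᵇ f xs / 1) * w  ≡⟨ ℚₚ.*-distribʳ-+ w 1ℚ (+ countᵇ f xs / 1) ⟨
  (1ℚ + + countᵇ f xs / 1) * w      ≡⟨ cong (_* w) ([m+n]/1≡m/1+n/1 1 (countᵇ f xs)) ⟨
  (+ suc (countᵇ f xs) / 1) * w     ∎
  where open ≡-Reasoning
... | false = begin
  h x + sumℚ (map h xs)             ≡⟨ cong₂ _+_ (trans (h≡ x) (cong (λ b → indicator b * w) fx))
                                                  (sumℚ-indicator f w h≡ xs) ⟩
  0ℚ * w + (+ countᵇ f xs / 1) * w  ≡⟨ cong (_+ (+ countᵇ f xs / 1) * w) (ℚₚ.*-zeroˡ w) ⟩
  0ℚ + (+ countᵇ f xs / 1) * w      ≡⟨ ℚₚ.+-identityˡ _ ⟩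
  (+ countᵇ f xs / 1) * w           ∎
  where open ≡-Reasoning

sumℚ-≤-scaled : ∀ {A : Set} ε (f g : A → ℚ) xs → (∀ x → x ∈ xs → f x ≤ ε * g x) →
                sumℚ (map f xs) ≤ ε * sumℚ (map g xs)
sumℚ-≤-scaled ε f g []       _   = ℚₚ.≤-reflexive (sym (ℚₚ.*-zeroʳ ε))
sumℚ-≤-scaled ε f g (x ∷ xs) f≤g = ℚₚ.≤-trans
  (ℚₚ.+-mono-≤ (f≤g x (here refl)) (sumℚ-≤-scaled ε f g xs (λ y y∈ → f≤g y (there y∈))))
  (ℚₚ.≤-reflexive (sym (ℚₚ.*-distribˡ-+ ε (g x) (sumℚ (map g xs)))))

sumℚ-nonNeg : ∀ {A : Set} (g : A → ℚ) xs → (∀ x → 0ℚ ≤ g x) → 0ℚ ≤ sumℚ (map g xs)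
sumℚ-nonNeg g []       _      = ℚₚ.≤-refl
sumℚ-nonNeg g (x ∷ xs) 0≤g = ℚₚ.+-mono-≤ (0≤g x) (sumℚ-nonNeg g xs 0≤g)

*-nonNeg : ∀ {p q} → 0ℚ ≤ p → 0ℚ ≤ q → 0ℚ ≤ p * q
*-nonNeg {p} {q} 0≤p 0≤q = ℚₚ.nonNegative⁻¹ (p * q) {{ℚₚ.nonNeg*nonNeg⇒nonNeg p {{nonNegative 0≤p}} q {{nonNegative 0≤q}}}}

inv-nonNeg : ∀ k → 0ℚ ≤ inv k
inv-nonNeg zero    = ℚₚ.≤-refl
inv-nonNeg (suc k) = 0≤/ 1 k

indicator-nonNeg : ∀ b → 0ℚ ≤ indicator b
indicator-nonNeg true  = 0≤/ 1 0
indicator-nonNeg false = ℚₚ.≤-refl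

condProb≤ : ∀ {p q ε} → 0ℚ < ε → 0ℚ ≤ q → p ≤ ε * q → condProb p q ≤ ε
condProb≤ {p} {q} {ε} 0<ε 0≤q p≤εq with q ℚₚ.≟ 0ℚ
... | yes _   = ℚₚ.<⇒≤ 0<ε
... | no q≢0 = begin
  p * 1/ q          ≤⟨ ℚₚ.*-monoʳ-≤-nonNeg (1/ q) p≤εq ⟩
  ε * q * 1/ q      ≡⟨ ℚₚ.*-assoc ε q (1/ q) ⟩
  ε * (q * 1/ q)    ≡⟨ cong (ε *_) (ℚₚ.*-inverseʳ q) ⟩
  ε * 1ℚ            ≡⟨ ℚₚ.*-identityʳ ε ⟩
  ε                 ∎
  where
  open ℚₚ.≤-Reasoning
  instance
    q≢0′ : NonZero q
    q≢0′ = ≢-nonZero q≢0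
    0≤q′ : NonNegative q
    0≤q′ = nonNegative 0≤q
    0<q : Positive q
    0<q = ℚₚ.nonNeg∧nonZero⇒pos q
    0<1/q : Positive (1/ q)
    0<1/q = ℚₚ.1/pos⇒pos q
    0≤1/q : NonNegative (1/ q)
    0≤1/q = ℚₚ.pos⇒nonNeg (1/ q)

count/length≤ : ∀ b c L → suc b ℕ.* c ℕ.≤ L → (+ c / 1) * inv L ≤ + 1 / suc b
count/length≤ b c zero    _ = subst (_≤ + 1 / suc b) (sym (ℚₚ.*-zeroʳ (+ c / 1))) (0≤/ 1 b)
count/length≤ b c (suc l) [1+b]c≤1+l = subst (_≤ + 1 / suc b) (sym ([a/b]*[c/d]≡[a*c]/[b*d] c 0 1 l))
  (/-mono-≤ (c ℕ.* 1) _ 1 b (subst₂ ℕ._≤_ c[1+b]≡ 1+l≡ [1+b]c≤1+l))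
  where
  c[1+b]≡ : suc b ℕ.* c ≡ c ℕ.* 1 ℕ.* suc b
  c[1+b]≡ = trans (ℕₚ.*-comm (suc b) c) (cong (ℕ._* suc b) (sym (ℕₚ.*-identityʳ c)))
  1+l≡ : suc l ≡ 1 ℕ.* (1 ℕ.* suc l)
  1+l≡ = sym (trans (ℕₚ.*-identityˡ _) (ℕₚ.*-identityˡ _))

≤[1/[1+q]]*n⇒*[1+q]≤n : ∀ a q n → + a / 1 ≤ (+ 1 / suc q) * (+ n / 1) → a ℕ.* suc q ℕ.≤ n
≤[1/[1+q]]*n⇒*[1+q]≤n a q n a≤n/[1+q] = subst₂ ℕ._≤_ (cong (λ m → a ℕ.* suc m) (ℕₚ.*-identityʳ q))
  (trans (ℕₚ.*-identityʳ (1 ℕ.* n)) (ℕₚ.*-identityˡ n))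
  (/-cancel-≤ a 0 (1 ℕ.* n) _ (subst (+ a / 1 ≤_) ([a/b]*[c/d]≡[a*c]/[b*d] 1 q n 0) a≤n/[1+q]))

-- For fixed (e₁, e₂), with a = 1/|binom([n],r)| and c = 1/|𝒜({e₁})|: the e₃-sum in Pr(𝒜₂ ∩ 𝒞)
-- is at most ε times the (e₁, e₂)-term of Pr(𝒜₂).
𝒞-sum≤ : ∀ {n K} b ε a c (e₁ e₂ : Subset n) → ∣ e₁ ∣ ≡ suc K → ∣ e₂ ∣ ≡ suc K →
         suc (suc (suc b) ℕ.* ((K ℕ.+ K) ℕ.* K)) ℕ.≤ n → + 1 / suc b ≤ ε → 0ℚ ≤ a → 0ℚ ≤ c →
         sumℚ (map (λ e₃ → indicator (isA2 e₁ e₂ ∧ isC e₁ e₂ e₃)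
                          * (a * (c * inv (length (avail n (suc K) (e₁ ∷ e₂ ∷ []))))))
                   (avail n (suc K) (e₁ ∷ e₂ ∷ [])))
           ≤ ε * (indicator (isA2 e₁ e₂) * (a * c))
𝒞-sum≤ {n} {K} b ε a c e₁ e₂ ∣e₁∣≡1+K ∣e₂∣≡1+K bound 1/[1+b]≤ε 0≤a 0≤c with isA2 e₁ e₂ in 𝒜₂
... | false = ℚₚ.≤-reflexive (begin-equality
  sumℚ (map (λ _ → 0ℚ * w) A₂)                ≡⟨ sumℚ-indicator (λ _ → false) w (λ _ → refl) A₂ ⟩
  (+ countᵇ (λ _ → false) A₂ / 1) * w         ≡⟨ cong (λ k → (+ k / 1) * w) (countᵇ-none (λ _ → refl) A₂) ⟩
  0ℚ * w                                      ≡⟨ ℚₚ.*-zeroˡ w ⟩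
  0ℚ                                          ≡⟨ ℚₚ.*-zeroʳ ε ⟨
  ε * 0ℚ                                      ≡⟨ cong (ε *_) (ℚₚ.*-zeroˡ (a * c)) ⟨
  ε * (0ℚ * (a * c))                          ∎)
  where
  open ℚₚ.≤-Reasoning
  A₂ = avail n (suc K) (e₁ ∷ e₂ ∷ [])
  w = a * (c * inv (length A₂))
... | true = begin
  sumℚ (map (λ e₃ → indicator (isC e₁ e₂ e₃) * (a * (c * inv L))) A₂)
                                     ≡⟨ sumℚ-indicator (isC e₁ e₂) (a * (c * inv L)) (λ _ → refl) A₂ ⟩
  #𝒞 * (a * (c * inv L))             ≡⟨ regroup #𝒞 (inv L) ⟩
  (#𝒞 * inv L) * (a * c)             ≤⟨ ℚₚ.*-monoʳ-≤-nonNeg (a * c) {{nonNegative (*-nonNeg 0≤a 0≤c)}}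
                                          (ℚₚ.≤-trans (count/length≤ b _ L p*#𝒞≤L) 1/[1+b]≤ε) ⟩
  ε * (a * c)                        ≡⟨ cong (ε *_) (ℚₚ.*-identityˡ (a * c)) ⟨
  ε * (1ℚ * (a * c))                 ∎
  where
  open ℚₚ.≤-Reasoning
  A₂ = avail n (suc K) (e₁ ∷ e₂ ∷ [])
  L = length A₂
  #𝒞 = + countᵇ (isC e₁ e₂) A₂ / 1
  p*#𝒞≤L = p*#𝒞≤#A₂ (suc b) ∣e₁∣≡1+K ∣e₂∣≡1+K (isA2⇒∣e₁∩e₂∣≡1 e₁ e₂ 𝒜₂) bound
  regroup : ∀ x y → x * (a * (c * y)) ≡ (x * y) * (a * c)
  regroup x y = begin-equality
    x * (a * (c * y))  ≡⟨ cong (x *_) (ℚₚ.*-assoc a c y) ⟨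
    x * ((a * c) * y)  ≡⟨ cong (x *_) (ℚₚ.*-comm (a * c) y) ⟩
    x * (y * (a * c))  ≡⟨ ℚₚ.*-assoc x y (a * c) ⟨
    (x * y) * (a * c)  ∎

probCgivenA2≤ : ∀ n K b ε → 0ℚ < ε → + 1 / suc b ≤ ε → suc (suc (suc b) ℕ.* ((K ℕ.+ K) ℕ.* K)) ℕ.≤ n →
                probCgivenA2 n (suc K) ≤ ε
probCgivenA2≤ n K b ε 0<ε 1/[1+b]≤ε bound = condProb≤ 0<ε 0≤probA2 probA2C≤ε*probA2
  where
  r = suc K
  a = inv (length (rSets n r))
  c : Subset n → ℚ
  c e₁ = inv (length (avail n r (e₁ ∷ [])))
  0≤probA2 : 0ℚ ≤ probA2 n r
  0≤probA2 = sumℚ-nonNeg _ (rSets n r) λ e₁ → sumℚ-nonNeg _ (avail n r (e₁ ∷ [])) λ e₂ →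
    *-nonNeg (indicator-nonNeg (isA2 e₁ e₂))
             (*-nonNeg (inv-nonNeg (length (rSets n r))) (inv-nonNeg (length (avail n r (e₁ ∷ [])))))
  probA2C≤ε*probA2 : probA2C n r ≤ ε * probA2 n r
  probA2C≤ε*probA2 =
    sumℚ-≤-scaled ε _ _ (rSets n r) λ e₁ e₁∈ → sumℚ-≤-scaled ε _ _ (avail n r (e₁ ∷ [])) λ e₂ e₂∈ →
    𝒞-sum≤ b ε a (c e₁) e₁ e₂ (∈rSets⇒∣e∣≡r e₁∈) (∈rSets⇒∣e∣≡r (∈avail⇒∈rSets {F = e₁ ∷ []} e₂∈))
      bound 1/[1+b]≤ε (inv-nonNeg (length (rSets n r))) (inv-nonNeg (length (avail n r (e₁ ∷ []))))

lemma4 : (r : ℕ → ℕ)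
    → (∀ n → r n ≥ 1)
    → (∀ (ε : ℚ) → 0ℚ < ε → Σ ℕ (λ N → ∀ n → n ≥ N → (+ (r n ^ 2)) / 1 ≤ ε * ((+ n) / 1)))
    → ∀ (ε : ℚ) → 0ℚ < ε → Σ ℕ (λ N → ∀ n → n ≥ N → probCgivenA2 n (r n) ≤ ε)
lemma4 r r≥1 r²=o[n] ε 0<ε = N , λ n n≥N → bound n (r n) (r≥1 n)
  (≤[1/[1+q]]*n⇒*[1+q]≤n (r n ^ 2) (q ℕ.+ q) n (r²≤n/[1+2q] n n≥N))
  where
  b = proj₁ (archimedean ε 0<ε)
  q = suc (suc b)
  N = proj₁ (r²=o[n] (+ 1 / suc (q ℕ.+ q)) (0</ 0 (q ℕ.+ q)))
  r²≤n/[1+2q] = proj₂ (r²=o[n] (+ 1 / suc (q ℕ.+ q)) (0</ 0 (q ℕ.+ q)))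
  bound : ∀ n R → R ≥ 1 → R ^ 2 ℕ.* suc (q ℕ.+ q) ℕ.≤ n → probCgivenA2 n R ≤ ε
  bound n (suc K) _ R²[1+2q]≤n =
    probCgivenA2≤ n K b ε 0<ε (proj₂ (archimedean ε 0<ε))
      (ℕₚ.≤-trans (1+q*[2K*K]≤[1+K]^2*[1+2q] K q) R²[1+2q]≤n)
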